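{- For a given instance $I$ of SPA-ST, the following hold: (1) each lecturer is assigned the same number of students in all super-stable matchings; (2) exactly the same students are unassigned in all super-stable matchings; (3) a project offered by a lecturer who is undersubscribed (in a super-stable matching) is assigned the same number of students in all super-stable matchings.
   Context: An instance $I$ of SPA-ST consists of a set $\mathcal{S}$ of students, a set $\mathcal{P}$ of projects and a set $\mathcal{L}$ of lecturers. Each student $s_i$ has a set $A_i\subseteq\mathcal{P}$ of acceptable projects and a preference list ranking $A_i$ as a strict ranking of ties (a tie is a set of equally preferred entries; a non-tied entry is a tie of length one). Each lecturer $l_k$ offers a non-empty set $P_k$ of projects, the sets $P_k$ partitioning $\mathcal{P}$; $l_k$ has a capacity $d_k\in\mathbb{Z}^+$ and a preference list ranking, as a strict ranking of ties, exactly those students who find at least one project in $P_k$ acceptable. Each project $p_j$ has capacity $c_j\in\mathbb{Z}^+$, with $\max\{c_j:p_j\in P_k\}\le d_k\le\sum\{c_j:p_j\in P_k\}$. A matching is a set $M$ of acceptable (student, project) pairs with each student in at most one pair, $|M(p_j)|\le c_j$ and $|M(l_k)|\le d_k$, where $M(p_j)$ is the set of students assigned to $p_j$ and $M(l_k)$ the set of students assigned to projects in $P_k$; $M(s_i)$ is the project of $s_i$ if any. A project/lecturer is undersubscribed or full according as its number of assignees is less than or equal to its capacity. Let $l_k$ be the lecturer offering $p_j$. $M$ is super-stable if no acceptable pair $(s_i,p_j)\notin M$ satisfies: (a) $s_i$ is unassigned, or prefers $p_j$ to $M(s_i)$ or is indifferent between them, and (b) either (i) $p_j$ and $l_k$ are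 undersubscribed, or (ii) $p_j$ is undersubscribed, $l_k$ is full and either $s_i\in M(l_k)$ or $l_k$ prefers $s_i$ to a worst student in $M(l_k)$ or is indifferent between them, or (iii) $p_j$ is full and $l_k$ prefers $s_i$ to a worst student in $M(p_j)$ or is indifferent between them. -}

module Defs where

open import Data.Nat using (ℕ; zero; suc; _+_; _≤_; _<_)
open import Data.Fin using (Fin; _≟_)
import Data.Fin as F
open import Data.Bool using (Bool; true; false; if_then_else_; T)
open import Data.Maybe using (Maybe; just; nothing)
open import Data.Product using (Σ; _×_; ∃; ∃-syntax)
open import Data.Sum using (_⊎_)
open import Relation.Nullary using (¬_)
open import Relation.Nullary.Decidable using (⌊_⌋)
open import Relation.Binary.PropositionalEquality using (_≡_)
open import Function using (_∘_)

sumFin : ∀ {n} → (Fin n → ℕ) → ℕ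
sumFin {zero}  f = 0
sumFin {suc n} f = f F.zero + sumFin (f ∘ F.suc)

countFin : ∀ {n} → (Fin n → Bool) → ℕ
countFin f = sumFin (λ i → if f i then 1 else 0)

-- Preference lists that are strict rankings of ties are encoded by rank
-- functions: smaller rank = more preferred, equal rank = tied (indifferent).
record SPAST : Set where
  field
    nS nP nL : ℕ
    acc      : Fin nS → Fin nP → Bool
    -- student preference ranks (meaningful on acceptable projects)
    srank    : Fin nS → Fin nP → ℕ
    -- the lecturer offering each project (the P_k partition the projects)
    lec      : Fin nP → Fin nL
    lec-nonempty : ∀ (k : Fin nL) → ∃[ j ] (lec j ≡ k)
    -- lecturer preference ranks (meaningful on students finding some
    -- project of the lecturer acceptable)
    lrank    : Fin nL → Fin nS → ℕ
    cP       : Fin nP → ℕ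
    dL       : Fin nL → ℕ
    cP-pos   : ∀ j → 1 ≤ cP j
    dL-pos   : ∀ k → 1 ≤ dL k
    cP≤dL    : ∀ j → cP j ≤ dL (lec j)
    dL≤ΣcP   : ∀ k → dL k ≤ sumFin (λ j → if ⌊ lec j ≟ k ⌋ then cP j else 0)

module _ (I : SPAST) where
  open SPAST I

  Assignment : Set
  Assignment = Fin nS → Maybe (Fin nP)

  inProj : Maybe (Fin nP) → Fin nP → Bool
  inProj nothing  p = false
  inProj (just q) p = ⌊ q ≟ p ⌋

  inLec : Maybe (Fin nP) → Fin nL → Bool
  inLec nothing  k = false
  inLec (just q) k = ⌊ lec q ≟ k ⌋

  projCount : Assignment → Fin nP → ℕ
  projCount M p = countFin (λ s → inProj (M s) p)

  lecCount : Assignment → Fin nL → ℕ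
  lecCount M k = countFin (λ s → inLec (M s) k)

  IsMatching : Assignment → Set
  IsMatching M =
      (∀ s p → M s ≡ just p → T (acc s p))
    × (∀ p → projCount M p ≤ cP p)
    × (∀ k → lecCount M k ≤ dL k)

  IsWorstIn : Fin nL → (Fin nS → Bool) → Fin nS → Set
  IsWorstIn k inS w = T (inS w) × (∀ s → T (inS s) → lrank k s ≤ lrank k w)

  PrefOrIndiffToWorst : Fin nL → (Fin nS → Bool) → Fin nS → Set
  PrefOrIndiffToWorst k inS s = ∃[ w ] (IsWorstIn k inS w × lrank k s ≤ lrank k w)

  Blocks : Assignment → Fin nS → Fin nP → Set
  Blocks M s p =
      T (acc s p)
    × ¬ (M s ≡ just p)
    × ( (M s ≡ nothing ⊎ ∃[ q ] (M s ≡ just q × srank s p ≤ srank s q))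
      × (
          (projCount M p < cP p × lecCount M (lec p) < dL (lec p))
        ⊎
          (projCount M p < cP p × lecCount M (lec p) ≡ dL (lec p)
            × (T (inLec (M s) (lec p))
               ⊎ PrefOrIndiffToWorst (lec p) (λ s' → inLec (M s') (lec p)) s))
        ⊎
          (projCount M p ≡ cP p
            × PrefOrIndiffToWorst (lec p) (λ s' → inProj (M s') p) s)))

  SuperStable : Assignment → Set
  SuperStable M = IsMatching M × (∀ s p → ¬ Blocks M s p)

module Submission where

-- Fix super-stable M and M'.  A student "favours M" if it is assigned in M
-- and weakly prefers M(s) to a different M'(s), being unassigned counting as worst.
-- Since M' is super-stable it refuses such a student at its M-project: the project, or
-- its lecturer, is full in M' and strictly prefers all its current students.  Using this
-- we show, lecturer by lecturer, that M' holds at least as many favourers of M as M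
-- does (module Compare), distinguishing "filled" lecturers (some favourer's M-project is
-- undersubscribed in M') from "spread" ones (each project can be treated separately).
-- Each favourer is counted once over all lecturers in M and at most once in M', so all
-- these inequalities are equalities and every favourer of M is assigned in M'.
-- Running the argument in both directions gives the three parts (module Agreement).

open import Defs
open import Data.Nat using (ℕ; zero; suc; _+_; _≤_; _<_; z≤n; _<?_)
open import Data.Nat.Properties
  using ( module ≤-Reasoning; ≤-refl; ≤-trans; ≤-reflexive; ≤-antisym
        ; <-irrefl; <-asym; ≤-<-trans; <⇒≤; ≰⇒>
        ; +-identityʳ; +-mono-≤; +-monoʳ-≤; +-monoˡ-≤; +-cancelˡ-≤; +-cancelʳ-≤
        ; n≤0⇒n≡0; m≤n+m; m≤m+n; m≤n⇒m<n∨m≡n; +-commutativeSemigroup; _≤?_ )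
open import Algebra.Properties.CommutativeSemigroup +-commutativeSemigroup using (interchange)
open import Data.Fin using (Fin; _≟_)
import Data.Fin as F
open import Data.Fin.Properties using (any?)
open import Data.Bool using (Bool; true; false; if_then_else_; T; _∧_; not)
open import Data.Bool.Properties using (T?; ∧-identityʳ; ∧-zeroʳ; ∧-comm)
open import Data.Maybe using (Maybe; just; nothing; is-just)
import Data.Maybe as Maybe
import Data.Maybe.Properties as Maybe
open import Data.List using (allFin; filter)
open import Data.List.Relation.Unary.All using (lookup)
open import Data.List.Relation.Unary.All.Properties using (all-filter)
open import Data.List.Membership.Propositional.Properties using (∈-allFin; ∈-filter⁺)
open import Data.List.Extrema.Nat using (argmax; argmax-all; f[xs]≤f[argmax])
open import Data.Product using (_×_; _,_; ∃-syntax)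
open import Data.Sum using (_⊎_; inj₁; inj₂; [_,_]′)
open import Data.Empty using (⊥-elim)
open import Function using (_∘_)
open import Function.Bundles using (_⇔_; mk⇔)
open import Relation.Nullary using (¬_; Dec; yes; no; ¬?)
open import Relation.Nullary.Decidable
  using (⌊_⌋; _×-dec_; decidable-stable; toWitness; fromWitness)
open import Relation.Binary.PropositionalEquality

sumFin-cong : ∀ {n} {f g : Fin n → ℕ} → (∀ i → f i ≡ g i) → sumFin f ≡ sumFin g
sumFin-cong {zero}  e = refl
sumFin-cong {suc n} e = cong₂ _+_ (e F.zero) (sumFin-cong (e ∘ F.suc))

sumFin-mono : ∀ {n} {f g : Fin n → ℕ} → (∀ i → f i ≤ g i) → sumFin f ≤ sumFin g
sumFin-mono {zero}  le = z≤n
sumFin-mono {suc n} le = +-mono-≤ (le F.zero) (sumFin-mono (le ∘ F.suc))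

sumFin-zero : ∀ {n} {f : Fin n → ℕ} → (∀ i → f i ≡ 0) → sumFin f ≡ 0
sumFin-zero {zero}  e = refl
sumFin-zero {suc n} e = cong₂ _+_ (e F.zero) (sumFin-zero (e ∘ F.suc))

sumFin-+ : ∀ {n} (f g : Fin n → ℕ) → sumFin (λ i → f i + g i) ≡ sumFin f + sumFin g
sumFin-+ {zero}  f g = refl
sumFin-+ {suc n} f g = begin
  (f F.zero + g F.zero) + sumFin (λ i → f (F.suc i) + g (F.suc i))
    ≡⟨ cong ((f F.zero + g F.zero) +_) (sumFin-+ (f ∘ F.suc) (g ∘ F.suc)) ⟩
  (f F.zero + g F.zero) + (sumFin (f ∘ F.suc) + sumFin (g ∘ F.suc))
    ≡⟨ interchange (f F.zero) (g F.zero) _ _ ⟩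
  (f F.zero + sumFin (f ∘ F.suc)) + (g F.zero + sumFin (g ∘ F.suc)) ∎
  where open ≡-Reasoning

sumFin-swap : ∀ {m n} (f : Fin m → Fin n → ℕ) →
  sumFin (λ i → sumFin (f i)) ≡ sumFin (λ j → sumFin (λ i → f i j))
sumFin-swap {zero} {n} f = sym (sumFin-zero {n} (λ _ → refl))
sumFin-swap {suc m} f = begin
  sumFin (f F.zero) + sumFin (λ i → sumFin (f (F.suc i)))
    ≡⟨ cong (sumFin (f F.zero) +_) (sumFin-swap (f ∘ F.suc)) ⟩
  sumFin (f F.zero) + sumFin (λ j → sumFin (λ i → f (F.suc i) j))
    ≡⟨ sym (sumFin-+ (f F.zero) _) ⟩
  sumFin (λ j → f F.zero j + sumFin (λ i → f (F.suc i) j)) ∎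
  where open ≡-Reasoning

sumFin-≥ : ∀ {n} (f : Fin n → ℕ) i → f i ≤ sumFin f
sumFin-≥ f F.zero    = m≤m+n (f F.zero) _
sumFin-≥ f (F.suc i) = ≤-trans (sumFin-≥ (f ∘ F.suc) i) (m≤n+m _ (f F.zero))

sumFin-tight : ∀ {n} {f g : Fin n → ℕ} → (∀ i → f i ≤ g i) → sumFin g ≤ sumFin f →
  ∀ i → f i ≡ g i
sumFin-tight {suc n} {f} {g} le ge F.zero = ≤-antisym (le F.zero)
  (+-cancelʳ-≤ _ _ _ (≤-trans ge (+-monoʳ-≤ (f F.zero) (sumFin-mono (le ∘ F.suc)))))
sumFin-tight {suc n} {f} {g} le ge (F.suc i) = sumFin-tight (le ∘ F.suc)
  (+-cancelˡ-≤ (g F.zero) _ _ (≤-trans ge (+-monoˡ-≤ _ (le F.zero)))) i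

sumOver : ∀ {n} → (Fin n → Bool) → (Fin n → ℕ) → ℕ
sumOver G f = sumFin (λ i → if G i then f i else 0)

restrict-≤ : ∀ {n} (G : Fin n → Bool) {f g : Fin n → ℕ} → (∀ i → T (G i) → f i ≤ g i) →
  ∀ i → (if G i then f i else 0) ≤ (if G i then g i else 0)
restrict-≤ G le i with G i | le i
... | true  | le-i = le-i _
... | false | _    = z≤n

sumOver-mono : ∀ {n} (G : Fin n → Bool) {f g : Fin n → ℕ} →
  (∀ i → T (G i) → f i ≤ g i) → sumOver G f ≤ sumOver G g
sumOver-mono G le = sumFin-mono (restrict-≤ G le)

sumOver-cong : ∀ {n} (G : Fin n → Bool) {f g : Fin n → ℕ} →
  (∀ i → T (G i) → f i ≡ g i) → sumOver G f ≡ sumOver G g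
sumOver-cong G e = ≤-antisym (sumOver-mono G (λ i i∈G → ≤-reflexive (e i i∈G)))
                             (sumOver-mono G (λ i i∈G → ≤-reflexive (sym (e i i∈G))))

sumOver-tight : ∀ {n} (G : Fin n → Bool) {f g : Fin n → ℕ} →
  (∀ i → T (G i) → f i ≤ g i) → sumOver G g ≤ sumOver G f → ∀ i → T (G i) → f i ≡ g i
sumOver-tight G {f} {g} le ge i i∈G = unrestrict (sumFin-tight (restrict-≤ G le) ge i) i∈G
  where
  unrestrict : (if G i then f i else 0) ≡ (if G i then g i else 0) → T (G i) → f i ≡ g i
  unrestrict eq with G i
  ... | true  = λ _ → eq
  ... | false = ⊥-elim

Sel : ℕ → Set
Sel n = Fin n → Bool

infixl 7 _∩_ _∖_
_∩_ _∖_ : ∀ {n} → Sel n → Sel n → Sel n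
(X ∩ Y) i = X i ∧ Y i
(X ∖ Y) i = X i ∧ not (Y i)

_⊆_ : ∀ {n} → Sel n → Sel n → Set
X ⊆ Y = ∀ i → T (X i) → T (Y i)

Disjoint : ∀ {n} → Sel n → Sel n → Set
Disjoint X R = ∀ i → T (X i) → ¬ T (R i)

∣_∣ : ∀ {n} → Sel n → ℕ
∣ X ∣ = countFin X

𝟙 : Bool → ℕ
𝟙 b = if b then 1 else 0

count-cong : ∀ {n} {X Y : Sel n} → (∀ i → X i ≡ Y i) → ∣ X ∣ ≡ ∣ Y ∣
count-cong e = sumFin-cong (cong 𝟙 ∘ e)

count-mono : ∀ {n} (X Y : Sel n) → X ⊆ Y → ∣ X ∣ ≤ ∣ Y ∣
count-mono X Y X⊆Y = sumFin-mono pointwise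
  where
  pointwise : ∀ i → 𝟙 (X i) ≤ 𝟙 (Y i)
  pointwise i with X i | Y i | X⊆Y i
  ... | false | _     | _       = z≤n
  ... | true  | true  | _       = ≤-refl
  ... | true  | false | X⊆Y-at-i = ⊥-elim (X⊆Y-at-i _)

count-split : ∀ {n} (X R : Sel n) → ∣ X ∣ ≡ ∣ X ∩ R ∣ + ∣ X ∖ R ∣
count-split X R = trans (sumFin-cong pointwise) (sumFin-+ (𝟙 ∘ (X ∩ R)) (𝟙 ∘ (X ∖ R)))
  where
  pointwise : ∀ i → 𝟙 (X i) ≡ 𝟙 ((X ∩ R) i) + 𝟙 ((X ∖ R) i)
  pointwise i with X i | R i
  ... | true  | true  = refl
  ... | true  | false = refl
  ... | false | _     = refl

count-∩-≤ : ∀ {n} (X R : Sel n) → ∣ X ∩ R ∣ ≤ ∣ R ∣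
count-∩-≤ X R = count-mono (X ∩ R) R pointwise
  where
  pointwise : (X ∩ R) ⊆ R
  pointwise i with X i | R i
  ... | true | true = _

count-∖-≤ : ∀ {n} (X R : Sel n) → ∣ X ∖ R ∣ ≤ ∣ X ∣
count-∖-≤ X R = count-mono (X ∖ R) X pointwise
  where
  pointwise : (X ∖ R) ⊆ X
  pointwise i with X i
  ... | true = _

count-∖-mono : ∀ {n} (X Y R : Sel n) → (∀ i → T (X i) → ¬ T (R i) → T (Y i)) →
  ∣ X ∖ R ∣ ≤ ∣ Y ∖ R ∣
count-∖-mono X Y R X∖R⊆Y = count-mono (X ∖ R) (Y ∖ R) pointwise
  where
  pointwise : (X ∖ R) ⊆ (Y ∖ R)
  pointwise i with X i | R i | X∖R⊆Y i
  ... | true | false | X∖R⊆Y-at-i with Y i | X∖R⊆Y-at-i _ (λ ())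
  ...   | true | _ = _

count-disjoint : ∀ {n} (X R : Sel n) → Disjoint X R → ∣ X ∩ R ∣ ≡ 0
count-disjoint X R disjoint = sumFin-zero pointwise
  where
  pointwise : ∀ i → 𝟙 ((X ∩ R) i) ≡ 0
  pointwise i with X i | R i | disjoint i
  ... | false | _     | _            = refl
  ... | true  | false | _            = refl
  ... | true  | true  | disjoint-at-i = ⊥-elim (disjoint-at-i _ _)

count-disjoint-∖ : ∀ {n} (X R : Sel n) → Disjoint X R → ∣ X ∖ R ∣ ≡ ∣ X ∣
count-disjoint-∖ X R disjoint = sym (begin
  ∣ X ∣                 ≡⟨ count-split X R ⟩
  ∣ X ∩ R ∣ + ∣ X ∖ R ∣ ≡⟨ cong (_+ ∣ X ∖ R ∣) (count-disjoint X R disjoint) ⟩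
  ∣ X ∖ R ∣             ∎)
  where open ≡-Reasoning

count-member : ∀ {n} (X : Sel n) {i} → T (X i) → 1 ≤ ∣ X ∣
count-member X {i} i∈X = ≤-trans (one i∈X) (sumFin-≥ (𝟙 ∘ X) i)
  where
  one : T (X i) → 1 ≤ 𝟙 (X i)
  one i∈X with X i
  ... | true = ≤-refl

count-zero-disjoint : ∀ {n} (X R : Sel n) → ∣ X ∩ R ∣ ≡ 0 → Disjoint X R
count-zero-disjoint X R ∣X∩R∣≡0 i i∈X i∈R =
  <-irrefl (sym ∣X∩R∣≡0) (count-member (X ∩ R) (both i∈X i∈R))
  where
  both : T (X i) → T (R i) → T ((X ∩ R) i)
  both i∈X i∈R with X i | R i
  ... | true | true = _

count-⊆ : ∀ {n} (X Y : Sel n) → ∣ X ∣ ≤ ∣ Y ∩ X ∣ → X ⊆ Y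
count-⊆ X Y X≤Y∩X i i∈X = decidable-stable (T? (Y i))
  (count-zero-disjoint X (not ∘ Y) outside-empty i i∈X ∘ not-in)
  where
  not-in : ¬ T (Y i) → T (not (Y i))
  not-in i∉Y with Y i
  ... | true  = i∉Y _
  ... | false = _
  outside-empty : ∣ X ∩ (not ∘ Y) ∣ ≡ 0
  outside-empty = n≤0⇒n≡0 (+-cancelˡ-≤ ∣ X ∩ Y ∣ _ 0 (begin
    ∣ X ∩ Y ∣ + ∣ X ∖ Y ∣ ≡⟨ count-split X Y ⟨
    ∣ X ∣                 ≤⟨ X≤Y∩X ⟩
    ∣ Y ∩ X ∣             ≡⟨ count-cong (λ j → ∧-comm (Y j) (X j)) ⟩
    ∣ X ∩ Y ∣             ≡⟨ +-identityʳ _ ⟨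
    ∣ X ∩ Y ∣ + 0         ∎))
    where open ≤-Reasoning

record _≼[_]_ {n} (X R Y : Sel n) : Set where
  constructor ≼-intro
  field
    outnumbers    : ∣ X ∣ ≤ ∣ Y ∣
    fewer-outside : ∣ Y ∖ R ∣ ≤ ∣ X ∖ R ∣

≼-inside : ∀ {n} {X Y R : Sel n} → X ≼[ R ] Y → ∣ X ∩ R ∣ ≤ ∣ Y ∩ R ∣
≼-inside {X = X} {Y} {R} (≼-intro X≤Y Y∖R≤X∖R) = +-cancelʳ-≤ ∣ X ∖ R ∣ _ _ (begin
  ∣ X ∩ R ∣ + ∣ X ∖ R ∣ ≡⟨ count-split X R ⟨
  ∣ X ∣                 ≤⟨ X≤Y ⟩
  ∣ Y ∣                 ≡⟨ count-split Y R ⟩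
  ∣ Y ∩ R ∣ + ∣ Y ∖ R ∣ ≤⟨ +-monoʳ-≤ ∣ Y ∩ R ∣ Y∖R≤X∖R ⟩
  ∣ Y ∩ R ∣ + ∣ X ∖ R ∣ ∎)
  where open ≤-Reasoning

≼-tight : ∀ {n} {X Y R : Sel n} → X ≼[ R ] Y → ∣ Y ∩ R ∣ ≤ ∣ X ∩ R ∣ → ∣ X ∣ ≡ ∣ Y ∣
≼-tight {X = X} {Y} {R} (≼-intro X≤Y Y∖R≤X∖R) Y∩R≤X∩R = ≤-antisym X≤Y (begin
  ∣ Y ∣                 ≡⟨ count-split Y R ⟩
  ∣ Y ∩ R ∣ + ∣ Y ∖ R ∣ ≤⟨ +-mono-≤ Y∩R≤X∩R Y∖R≤X∖R ⟩
  ∣ X ∩ R ∣ + ∣ X ∖ R ∣ ≡⟨ count-split X R ⟨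
  ∣ X ∣                 ∎)
  where open ≤-Reasoning

≼-or-disjoint-inside : ∀ {n} {X Y R : Sel n} → X ≼[ R ] Y ⊎ Disjoint X R → ∣ X ∩ R ∣ ≤ ∣ Y ∩ R ∣
≼-or-disjoint-inside (inj₁ X≼Y) = ≼-inside X≼Y
≼-or-disjoint-inside {X = X} {R = R} (inj₂ disjoint) =
  ≤-trans (≤-reflexive (count-disjoint X R disjoint)) z≤n

worst-exists : ∀ {n} (X : Sel n) (r : Fin n → ℕ) {i} → T (X i) →
  ∃[ w ] (T (X w) × (∀ t → T (X t) → r t ≤ r w))
worst-exists {n} X r {i} i∈X = w , argmax-all r i∈X (all-filter members (allFin n)) , maximal
  where
  members : (t : Fin n) → Dec (T (X t))
  members t = T? (X t)
  w : Fin n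
  w = argmax r i (filter members (allFin n))
  maximal : ∀ t → T (X t) → r t ≤ r w
  maximal t t∈X = lookup (f[xs]≤f[argmax] i (filter members (allFin n)))
                         (∈-filter⁺ members (∈-allFin t) t∈X)

hits : ∀ {m} → Maybe (Fin m) → Sel m → Bool
hits nothing  G = false
hits (just j) G = G j

fibre : ∀ {m n} → (Fin n → Maybe (Fin m)) → Fin m → Sel n
fibre h i s = hits (h s) (λ j → ⌊ j ≟ i ⌋)

sum-pointMass : ∀ {m} (j : Fin m) (c : Sel m) → sumFin (λ i → 𝟙 (⌊ j ≟ i ⌋ ∧ c i)) ≡ 𝟙 (c j)
sum-pointMass {suc m} F.zero    c = trans (cong (𝟙 (c F.zero) +_) (sumFin-zero {m} (λ _ → refl)))
                                           (+-identityʳ _)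
sum-pointMass {suc m} (F.suc j) c =
  trans (sumFin-cong (λ i → cong (λ b → 𝟙 (b ∧ c (F.suc i))) (≟-suc j i)))
        (sum-pointMass j (c ∘ F.suc))
  where
  ≟-suc : ∀ (j i : Fin m) → ⌊ F.suc j ≟ F.suc i ⌋ ≡ ⌊ j ≟ i ⌋
  ≟-suc j i with j ≟ i
  ... | yes _ = refl
  ... | no _  = refl

sum-fibres : ∀ {m n} (h : Fin n → Maybe (Fin m)) (G : Sel m) (Q : Sel n) →
  sumOver G (λ i → ∣ fibre h i ∩ Q ∣) ≡ ∣ (λ s → hits (h s) G) ∩ Q ∣
sum-fibres {m} h G Q = begin
  sumOver G (λ i → ∣ fibre h i ∩ Q ∣)
    ≡⟨ sumFin-cong restrict ⟩
  sumFin (λ i → sumFin (λ s → 𝟙 (fibre h i s ∧ (G i ∧ Q s))))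
    ≡⟨ sumFin-swap (λ i s → 𝟙 (fibre h i s ∧ (G i ∧ Q s))) ⟩
  sumFin (λ s → sumFin (λ i → 𝟙 (fibre h i s ∧ (G i ∧ Q s))))
    ≡⟨ sumFin-cong collapse ⟩
  ∣ (λ s → hits (h s) G) ∩ Q ∣ ∎
  where
  open ≡-Reasoning
  restrict : ∀ i → (if G i then ∣ fibre h i ∩ Q ∣ else 0)
                 ≡ sumFin (λ s → 𝟙 (fibre h i s ∧ (G i ∧ Q s)))
  restrict i with G i
  ... | true  = refl
  ... | false = sym (sumFin-zero (λ s → cong 𝟙 (∧-zeroʳ (fibre h i s))))
  collapse : ∀ s → sumFin (λ i → 𝟙 (fibre h i s ∧ (G i ∧ Q s))) ≡ 𝟙 (hits (h s) G ∧ Q s)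
  collapse s with h s
  ... | nothing = sumFin-zero {m} (λ _ → refl)
  ... | just j  = sum-pointMass j (λ i → G i ∧ Q s)

module Analysis (I : SPAST) where
  open SPAST I

  onProj : Assignment I → Fin nP → Sel nS
  onProj X p s = inProj I (X s) p

  onLec : Assignment I → Fin nL → Sel nS
  onLec X l s = inLec I (X s) l

  assigned : Assignment I → Sel nS
  assigned X s = is-just (X s)

  inProj-≡ : ∀ {a p} → T (inProj I a p) → a ≡ just p
  inProj-≡ {just q} q≡p = cong just (toWitness q≡p)

  ≡-inProj : ∀ {a p} → a ≡ just p → T (inProj I a p)
  ≡-inProj refl = fromWitness refl

  ≡-inLec : ∀ {a p l} → a ≡ just p → lec p ≡ l → T (inLec I a l)
  ≡-inLec refl lec-p≡l = fromWitness lec-p≡l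

  lecturer-sum : ∀ X l (Q : Sel nS) →
    sumOver (λ q → ⌊ lec q ≟ l ⌋) (λ q → ∣ onProj X q ∩ Q ∣) ≡ ∣ onLec X l ∩ Q ∣
  lecturer-sum X l Q = begin
    sumOver (λ q → ⌊ lec q ≟ l ⌋) (λ q → ∣ onProj X q ∩ Q ∣)
      ≡⟨ sumFin-cong (λ q → cong (λ c → if ⌊ lec q ≟ l ⌋ then c else 0)
                                 (count-cong (λ s → cong (_∧ Q s) (proj-fibre (X s) q)))) ⟩
    sumOver (λ q → ⌊ lec q ≟ l ⌋) (λ q → ∣ fibre X q ∩ Q ∣)
      ≡⟨ sum-fibres X (λ q → ⌊ lec q ≟ l ⌋) Q ⟩
    ∣ (λ s → hits (X s) (λ q → ⌊ lec q ≟ l ⌋)) ∩ Q ∣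
      ≡⟨ count-cong (λ s → cong (_∧ Q s) (lec-hits (X s))) ⟩
    ∣ onLec X l ∩ Q ∣ ∎
    where
    open ≡-Reasoning
    proj-fibre : ∀ a q → inProj I a q ≡ hits a (λ j → ⌊ j ≟ q ⌋)
    proj-fibre nothing  q = refl
    proj-fibre (just _) q = refl
    lec-hits : ∀ a → hits a (λ q → ⌊ lec q ≟ l ⌋) ≡ inLec I a l
    lec-hits nothing  = refl
    lec-hits (just _) = refl

  lecturer-total : ∀ X l → sumOver (λ q → ⌊ lec q ≟ l ⌋) (projCount I X) ≡ lecCount I X l
  lecturer-total X l = begin
    sumOver (λ q → ⌊ lec q ≟ l ⌋) (λ q → ∣ onProj X q ∣)
      ≡⟨ sumFin-cong (λ q → cong (λ c → if ⌊ lec q ≟ l ⌋ then c else 0)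
                                 (count-cong (λ s → sym (∧-identityʳ (onProj X q s))))) ⟩
    sumOver (λ q → ⌊ lec q ≟ l ⌋) (λ q → ∣ onProj X q ∩ (λ _ → true) ∣)
      ≡⟨ lecturer-sum X l (λ _ → true) ⟩
    ∣ onLec X l ∩ (λ _ → true) ∣
      ≡⟨ count-cong (λ s → ∧-identityʳ (onLec X l s)) ⟩
    ∣ onLec X l ∣ ∎
    where open ≡-Reasoning

  total-sum : ∀ X (Q : Sel nS) → sumFin (λ l → ∣ onLec X l ∩ Q ∣) ≡ ∣ assigned X ∩ Q ∣
  total-sum X Q = begin
    sumFin (λ l → ∣ onLec X l ∩ Q ∣)
      ≡⟨ sumFin-cong (λ l → count-cong (λ s → cong (_∧ Q s) (lec-fibre (X s) l))) ⟩
    sumOver (λ _ → true) (λ l → ∣ fibre lecOf l ∩ Q ∣)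
      ≡⟨ sum-fibres lecOf (λ _ → true) Q ⟩
    ∣ (λ s → hits (lecOf s) (λ _ → true)) ∩ Q ∣
      ≡⟨ count-cong (λ s → cong (_∧ Q s) (hits-assigned (X s))) ⟩
    ∣ assigned X ∩ Q ∣ ∎
    where
    open ≡-Reasoning
    lecOf : Fin nS → Maybe (Fin nL)
    lecOf s = Maybe.map lec (X s)
    lec-fibre : ∀ a l → inLec I a l ≡ hits (Maybe.map lec a) (λ j → ⌊ j ≟ l ⌋)
    lec-fibre nothing  l = refl
    lec-fibre (just _) l = refl
    hits-assigned : ∀ a → hits (Maybe.map lec a) (λ _ → true) ≡ is-just a
    hits-assigned nothing  = refl
    hits-assigned (just _) = refl

  Outranked : Fin nL → Sel nS → Fin nS → Set
  Outranked l X s = ∀ t → T (X t) → lrank l t < lrank l s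

  outranked : ∀ {l X s} → ¬ PrefOrIndiffToWorst I l X s → Outranked l X s
  outranked {l} {X} {s} not-worse t t∈X with worst-exists X (lrank l) t∈X
  ... | w , w∈X , worst = ≤-<-trans (worst t t∈X)
                            (≰⇒> (λ s≤w → not-worse (w , (w∈X , worst) , s≤w)))

  Covets : Assignment I → Fin nS → Fin nP → Set
  Covets N s p = N s ≡ nothing ⊎ ∃[ q ] (N s ≡ just q × srank s p ≤ srank s q)

  Room : Assignment I → Fin nS → Fin nP → Set
  Room N s p =
      (projCount I N p < cP p × lecCount I N (lec p) < dL (lec p))
    ⊎ (projCount I N p < cP p × lecCount I N (lec p) ≡ dL (lec p)
        × (T (onLec N (lec p) s) ⊎ PrefOrIndiffToWorst I (lec p) (onLec N (lec p)) s))
    ⊎ (projCount I N p ≡ cP p × PrefOrIndiffToWorst I (lec p) (onProj N p) s)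

  data Refusal (N : Assignment I) (s : Fin nS) (p : Fin nP) : Set where
    project-full  : projCount I N p ≡ cP p → Outranked (lec p) (onProj N p) s → Refusal N s p
    lecturer-full : projCount I N p < cP p → lecCount I N (lec p) ≡ dL (lec p) →
                    ¬ T (onLec N (lec p) s) → Outranked (lec p) (onLec N (lec p)) s →
                    Refusal N s p

  refusal-on-project : ∀ {N s p} → Refusal N s p → Outranked (lec p) (onProj N p) s
  refusal-on-project (project-full _ outranks) = outranks
  refusal-on-project {N} (lecturer-full _ _ _ outranks) t t∈p =
    outranks t (≡-inLec (inProj-≡ {N t} t∈p) refl)

  refuses : ∀ {N s p} → SuperStable I N → T (acc s p) → ¬ N s ≡ just p → Covets N s p →
    Refusal N s p
  refuses {N} {s} {p} ((_ , p-cap , l-cap) , unblocked) ok moved covets =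
    classify (m≤n⇒m<n∨m≡n (p-cap p)) (m≤n⇒m<n∨m≡n (l-cap (lec p)))
    where
    block : ¬ Room N s p
    block room = unblocked s p (ok , moved , covets , room)
    classify : projCount I N p < cP p ⊎ projCount I N p ≡ cP p →
               lecCount I N (lec p) < dL (lec p) ⊎ lecCount I N (lec p) ≡ dL (lec p) →
               Refusal N s p
    classify (inj₂ p-full)  _ =
      project-full p-full (outranked λ worse → block (inj₂ (inj₂ (p-full , worse))))
    classify (inj₁ p-under) (inj₁ l-under) = ⊥-elim (block (inj₁ (p-under , l-under)))
    classify (inj₁ p-under) (inj₂ l-full)  =
      lecturer-full p-under l-full
        (λ s∈l → block (inj₂ (inj₁ (p-under , l-full , inj₁ s∈l))))
        (outranked λ worse → block (inj₂ (inj₁ (p-under , l-full , inj₂ worse))))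

  favours : Fin nS → Maybe (Fin nP) → Maybe (Fin nP) → Bool
  favours s nothing  _        = false
  favours s (just p) nothing  = true
  favours s (just p) (just q) = not ⌊ p ≟ q ⌋ ∧ ⌊ srank s p ≤? srank s q ⌋

  Favour : Assignment I → Assignment I → Sel nS
  Favour X Y s = favours s (X s) (Y s)

  favour-covets : ∀ {X Y s p} → T (Favour X Y s) → X s ≡ just p → ¬ Y s ≡ just p × Covets Y s p
  favour-covets {X} {Y} {s} {p} = covets (X s) (Y s)
    where
    covets : ∀ a b → T (favours s a b) → a ≡ just p →
             ¬ b ≡ just p × (b ≡ nothing ⊎ ∃[ q ] (b ≡ just q × srank s p ≤ srank s q))
    covets (just p) nothing  _   refl = (λ ()) , inj₁ refl
    covets (just p) (just q) fav refl with p ≟ q | srank s p ≤? srank s q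
    ... | no p≢q | yes p≤q = (λ q≡p → p≢q (sym (Maybe.just-injective q≡p))) , inj₂ (q , refl , p≤q)
    ... | no _   | no _    = ⊥-elim fav
    ... | yes _  | _       = ⊥-elim fav

  unfavoured-covets : ∀ {X Y s p} → ¬ T (Favour X Y s) → Y s ≡ just p → ¬ X s ≡ just p →
    Covets X s p
  unfavoured-covets {X} {Y} {s} {p} = covets (X s) (Y s)
    where
    covets : ∀ a b → ¬ T (favours s a b) → b ≡ just p → ¬ a ≡ just p →
             a ≡ nothing ⊎ ∃[ q ] (a ≡ just q × srank s p ≤ srank s q)
    covets nothing  _ _ _ _ = inj₁ refl
    covets (just q) (just p) not-fav refl moved with q ≟ p | srank s q ≤? srank s p
    ... | yes q≡p | _       = ⊥-elim (moved (cong just q≡p))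
    ... | no _    | yes _   = ⊥-elim (not-fav _)
    ... | no _    | no q≰p  = inj₂ (q , refl , <⇒≤ (≰⇒> q≰p))

  favour-total : ∀ {X Y s p} → X s ≡ just p → ¬ Y s ≡ just p →
    T (Favour X Y s) ⊎ T (Favour Y X s)
  favour-total {X} {Y} {s} {p} = total (X s) (Y s)
    where
    total : ∀ a b → a ≡ just p → ¬ b ≡ just p → T (favours s a b) ⊎ T (favours s b a)
    total (just p) nothing  refl _ = inj₁ _
    total (just p) (just q) refl moved with p ≟ q | q ≟ p
    ... | yes p≡q | _       = ⊥-elim (moved (cong just (sym p≡q)))
    ... | no _    | yes q≡p = ⊥-elim (moved (cong just q≡p))
    ... | no _    | no _    with srank s p ≤? srank s q | srank s q ≤? srank s p
    ...   | yes _   | _       = inj₁ _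
    ...   | no _    | yes _   = inj₂ _
    ...   | no p≰q  | no q≰p  = ⊥-elim (p≰q (<⇒≤ (≰⇒> q≰p)))

  favour-assigned : ∀ X Y s → (assigned X ∩ Favour X Y) s ≡ Favour X Y s
  favour-assigned X Y s with X s
  ... | nothing = refl
  ... | just _  = refl

  unassigned-favours : ∀ {X Y s p} → X s ≡ nothing → Y s ≡ just p → T (Favour Y X s)
  unassigned-favours {X} {Y} {s} Xs Ys rewrite Xs | Ys = _

  accepts : ∀ {N s p} → SuperStable I N → N s ≡ just p → T (acc s p)
  accepts ((acceptable , _) , _) = acceptable _ _

  project-capacity : ∀ {N} → SuperStable I N → ∀ p → projCount I N p ≤ cP p
  project-capacity ((_ , p-cap , _) , _) = p-cap

  lecturer-capacity : ∀ {N} → SuperStable I N → ∀ l → lecCount I N l ≤ dL l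
  lecturer-capacity ((_ , _ , l-cap) , _) = l-cap

  module Compare (M M' : Assignment I) (ss : SuperStable I M) (ss' : SuperStable I M') where

    F : Sel nS
    F = Favour M M'

    favourer-refused : ∀ {s p} → T (F s) → M s ≡ just p → Refusal M' s p
    favourer-refused s∈F Ms with favour-covets {M} {M'} s∈F Ms
    ... | moved , covets = refuses ss' (accepts ss Ms) moved covets

    defector-refused : ∀ {t q} → ¬ T (F t) → M' t ≡ just q → ¬ M t ≡ just q → Refusal M t q
    defector-refused t∉F M't moved =
      refuses ss (accepts ss' M't) moved (unfavoured-covets {M} {M'} t∉F M't moved)

    defector-outranked : ∀ {t q} → ¬ T (F t) → M' t ≡ just q → ¬ M t ≡ just q →
      Outranked (lec q) (onProj M q) t
    defector-outranked t∉F M't moved = refusal-on-project (defector-refused t∉F M't moved)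

    Filled : Fin nL → Set
    Filled l = lecCount I M' l ≡ dL l × onLec M l ≼[ F ] onLec M' l

    Spread : Fin nL → Set
    Spread l = ∀ q → lec q ≡ l → onProj M q ≼[ F ] onProj M' q ⊎ Disjoint (onProj M q) F

    -- If a
    -- non-favourer x joined a project q of l in M', then q is full in M and holds no
    -- favourer, so q has no more non-favourers in M' than in M.
    newcomer-bound : ∀ {l s₀ q x} → T (onLec M l s₀) → Outranked l (onLec M' l) s₀ →
      lec q ≡ l → M' x ≡ just q → ¬ T (F x) → ¬ M x ≡ just q →
      ∣ onProj M' q ∖ F ∣ ≤ ∣ onProj M q ∖ F ∣
    newcomer-bound {s₀ = s₀} {q} {x} s₀∈l s₀-outranked refl M'x x∉F moved
      with defector-refused x∉F M'x moved
    ... | lecturer-full _ _ _ x-outranked =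
      ⊥-elim (<-asym (x-outranked s₀ s₀∈l) (s₀-outranked x (≡-inLec M'x refl)))
    ... | project-full q-full x-outranked = begin
      ∣ onProj M' q ∖ F ∣ ≤⟨ count-∖-≤ (onProj M' q) F ⟩
      ∣ onProj M' q ∣     ≤⟨ project-capacity ss' q ⟩
      cP q                ≡⟨ q-full ⟨
      ∣ onProj M q ∣      ≡⟨ count-disjoint-∖ (onProj M q) F no-favourer ⟨
      ∣ onProj M q ∖ F ∣  ∎
      where
      open ≤-Reasoning
      no-favourer : Disjoint (onProj M q) F
      no-favourer u u∈q u∈F = <-asym (x-outranked u u∈q)
        (refusal-on-project (favourer-refused u∈F (inProj-≡ u∈q)) x (≡-inProj M'x))

    no-gain : ∀ {l s₀ q} → T (onLec M l s₀) → Outranked l (onLec M' l) s₀ →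
      lec q ≡ l → ∣ onProj M' q ∖ F ∣ ≤ ∣ onProj M q ∖ F ∣
    no-gain {q = q} s₀∈l s₀-outranked q∈l
      with any? (λ x → Maybe.≡-dec _≟_ (M' x) (just q) ×-dec ¬? (T? (F x))
                         ×-dec ¬? (Maybe.≡-dec _≟_ (M x) (just q)))
    ... | yes (x , M'x , x∉F , moved) = newcomer-bound s₀∈l s₀-outranked q∈l M'x x∉F moved
    ... | no no-newcomer = count-∖-mono (onProj M' q) (onProj M q) F stays
      where
      stays : ∀ t → T (onProj M' q t) → ¬ T (F t) → T (onProj M q t)
      stays t t∈q t∉F = decidable-stable (T? _) λ t∉q →
        no-newcomer (t , inProj-≡ t∈q , t∉F , λ Mt → t∉q (≡-inProj Mt))

    filled : ∀ {s₀ p} → T (F s₀) → M s₀ ≡ just p → projCount I M' p < cP p → Filled (lec p)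
    filled {p = p} s₀∈F Ms₀ p-under with favourer-refused s₀∈F Ms₀
    ... | project-full p-full _ = ⊥-elim (<-irrefl p-full p-under)
    ... | lecturer-full _ l-full _ s₀-outranked = l-full , ≼-intro
      (subst (lecCount I M (lec p) ≤_) (sym l-full) (lecturer-capacity ss (lec p)))
      (subst₂ _≤_ (lecturer-sum M' (lec p) (not ∘ F)) (lecturer-sum M (lec p) (not ∘ F))
        (sumOver-mono (λ q → ⌊ lec q ≟ lec p ⌋)
          (λ q q∈l → no-gain {q = q} (≡-inLec Ms₀ refl) s₀-outranked (toWitness q∈l))))

    full-project-balanced : ∀ {s q} → M s ≡ just q → projCount I M' q ≡ cP q →
      Outranked (lec q) (onProj M' q) s → onProj M q ≼[ F ] onProj M' q
    full-project-balanced {s} {q} Ms q-full s-outranked = ≼-intro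
      (subst (projCount I M q ≤_) (sym q-full) (project-capacity ss q))
      (count-∖-mono (onProj M' q) (onProj M q) F stays)
      where
      stays : ∀ t → T (onProj M' q t) → ¬ T (F t) → T (onProj M q t)
      stays t t∈q t∉F = decidable-stable (T? _) λ t∉q → <-asym (s-outranked t t∈q)
        (defector-outranked t∉F (inProj-≡ t∈q) (λ Mt → t∉q (≡-inProj Mt)) s (≡-inProj Ms))

    spread : ∀ {l} →
      (∀ {s p} → T (F s) → M s ≡ just p → lec p ≡ l → ¬ projCount I M' p < cP p) → Spread l
    spread no-room q refl with any? (λ s → T? (F s) ×-dec Maybe.≡-dec _≟_ (M s) (just q))
    ... | no none = inj₂ (λ s s∈q s∈F → none (s , s∈F , inProj-≡ s∈q))
    ... | yes (s , s∈F , Ms) with favourer-refused s∈F Ms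
    ...   | project-full q-full s-outranked = inj₁ (full-project-balanced Ms q-full s-outranked)
    ...   | lecturer-full q-under _ _ _     = ⊥-elim (no-room s∈F Ms refl q-under)

    dichotomy : ∀ l → Filled l ⊎ Spread l
    dichotomy l with any? (λ s → any? (λ p →
      T? (F s) ×-dec Maybe.≡-dec _≟_ (M s) (just p) ×-dec lec p ≟ l ×-dec projCount I M' p <? cP p))
    ... | yes (s , p , s∈F , Ms , refl , p-under) = inj₁ (filled s∈F Ms p-under)
    ... | no none = inj₂ (spread λ s∈F Ms p∈l p-under → none (_ , _ , s∈F , Ms , p∈l , p-under))

    spread-≤ : ∀ {l} → Spread l → ∀ q → T ⌊ lec q ≟ l ⌋ → ∣ onProj M q ∩ F ∣ ≤ ∣ onProj M' q ∩ F ∣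
    spread-≤ spread-l q q∈l = ≼-or-disjoint-inside (spread-l q (toWitness q∈l))

    favourers-≤ : ∀ l → ∣ onLec M l ∩ F ∣ ≤ ∣ onLec M' l ∩ F ∣
    favourers-≤ l with dichotomy l
    ... | inj₁ (_ , balanced) = ≼-inside balanced
    ... | inj₂ spread-l = subst₂ _≤_ (lecturer-sum M l F) (lecturer-sum M' l F)
                            (sumOver-mono (λ q → ⌊ lec q ≟ l ⌋) (spread-≤ spread-l))

    favourers-in-M : sumFin (λ l → ∣ onLec M l ∩ F ∣) ≡ ∣ F ∣
    favourers-in-M = trans (total-sum M F) (count-cong (favour-assigned M M'))

    favourers-in-M' : sumFin (λ l → ∣ onLec M' l ∩ F ∣) ≤ ∣ F ∣
    favourers-in-M' = subst (_≤ ∣ F ∣) (sym (total-sum M' F)) (count-∩-≤ (assigned M') F)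

    favourer-balance : ∀ l → ∣ onLec M l ∩ F ∣ ≡ ∣ onLec M' l ∩ F ∣
    favourer-balance =
      sumFin-tight favourers-≤ (≤-trans favourers-in-M' (≤-reflexive (sym favourers-in-M)))

    favourers-assigned : F ⊆ assigned M'
    favourers-assigned = count-⊆ F (assigned M') (begin
      ∣ F ∣                              ≡⟨ favourers-in-M ⟨
      sumFin (λ l → ∣ onLec M l ∩ F ∣)  ≤⟨ sumFin-mono favourers-≤ ⟩
      sumFin (λ l → ∣ onLec M' l ∩ F ∣) ≡⟨ total-sum M' F ⟩
      ∣ assigned M' ∩ F ∣                ∎)
      where open ≤-Reasoning

    spread-balance : ∀ {l} → Spread l → ∀ q → lec q ≡ l →
      ∣ onProj M q ∩ F ∣ ≡ ∣ onProj M' q ∩ F ∣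
    spread-balance {l} spread-l q q∈l =
      sumOver-tight (λ q → ⌊ lec q ≟ l ⌋) (spread-≤ spread-l) (≤-reflexive (begin
        sumOver (λ q → ⌊ lec q ≟ l ⌋) (λ q → ∣ onProj M' q ∩ F ∣) ≡⟨ lecturer-sum M' l F ⟩
        ∣ onLec M' l ∩ F ∣                                          ≡⟨ favourer-balance l ⟨
        ∣ onLec M l ∩ F ∣                                           ≡⟨ lecturer-sum M l F ⟨
        sumOver (λ q → ⌊ lec q ≟ l ⌋) (λ q → ∣ onProj M q ∩ F ∣)  ∎))
        q (fromWitness q∈l)
      where open ≡-Reasoning

  unmoved : ∀ X Y {q} → Disjoint (onProj X q) (Favour X Y) → Disjoint (onProj X q) (Favour Y X) →
    onProj X q ⊆ onProj Y q
  unmoved X Y no-favourer no-favourer' s s∈q = decidable-stable (T? _) λ s∉q →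
    [ no-favourer s s∈q , no-favourer' s s∈q ]′
      (favour-total {X} {Y} (inProj-≡ s∈q) (λ Ys → s∉q (≡-inProj Ys)))

  -- Part (2): super-stable assignments leave the same students unassigned, since a
  -- student assigned only in Y favours Y and hence is assigned in X.
  unassigned-stays : ∀ {X Y} → SuperStable I X → SuperStable I Y →
    ∀ {s} → X s ≡ nothing → Y s ≡ nothing
  unassigned-stays {X} {Y} ssX ssY {s} Xs with Y s in Ys
  ... | nothing = refl
  ... | just q  = ⊥-elim (subst (T ∘ is-just) Xs
      (Compare.favourers-assigned Y X ssY ssX s (unassigned-favours {X} {Y} Xs Ys)))

  module Agreement (M M' : Assignment I) (ss : SuperStable I M) (ss' : SuperStable I M') where
    module Fwd = Compare M M' ss ss'
    module Bwd = Compare M' M ss' ss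

    projects-agree : ∀ {l} → Fwd.Spread l → Bwd.Spread l → ∀ q → lec q ≡ l →
      projCount I M q ≡ projCount I M' q
    projects-agree spread spread' q q∈l with spread q q∈l | spread' q q∈l
    ... | inj₁ balanced | _ =
      ≼-tight balanced (≤-reflexive (sym (Fwd.spread-balance spread q q∈l)))
    ... | inj₂ _ | inj₁ balanced' =
      sym (≼-tight balanced' (≤-reflexive (sym (Bwd.spread-balance spread' q q∈l))))
    ... | inj₂ no-favourer | inj₂ no-favourer' = ≤-antisym
      (count-mono (onProj M q) (onProj M' q) (unmoved M M' no-favourer no-favourer'-in-M))
      (count-mono (onProj M' q) (onProj M q) (unmoved M' M no-favourer' no-favourer-in-M'))
      where
      no-favourer-in-M' : Disjoint (onProj M' q) Fwd.F
      no-favourer-in-M' = count-zero-disjoint (onProj M' q) Fwd.F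
        (trans (sym (Fwd.spread-balance spread q q∈l))
               (count-disjoint (onProj M q) Fwd.F no-favourer))
      no-favourer'-in-M : Disjoint (onProj M q) Bwd.F
      no-favourer'-in-M = count-zero-disjoint (onProj M q) Bwd.F
        (trans (sym (Bwd.spread-balance spread' q q∈l))
               (count-disjoint (onProj M' q) Bwd.F no-favourer'))

    -- Part (1): every lecturer has the same number of students.  A filled lecturer is
    -- settled by the balance of favourers; otherwise sum over its projects.
    lecturers-agree : ∀ l → lecCount I M l ≡ lecCount I M' l
    lecturers-agree l with Fwd.dichotomy l | Bwd.dichotomy l
    ... | inj₁ (_ , balanced) | _ =
      ≼-tight balanced (≤-reflexive (sym (Fwd.favourer-balance l)))
    ... | inj₂ _ | inj₁ (_ , balanced') =
      sym (≼-tight balanced' (≤-reflexive (sym (Bwd.favourer-balance l))))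
    ... | inj₂ spread | inj₂ spread' = begin
      lecCount I M l                                       ≡⟨ lecturer-total M l ⟨
      sumOver (λ q → ⌊ lec q ≟ l ⌋) (projCount I M)
        ≡⟨ sumOver-cong (λ q → ⌊ lec q ≟ l ⌋)
             (λ q q∈l → projects-agree spread spread' q (toWitness q∈l)) ⟩
      sumOver (λ q → ⌊ lec q ≟ l ⌋) (projCount I M')       ≡⟨ lecturer-total M' l ⟩
      lecCount I M' l                                      ∎
      where open ≡-Reasoning

    -- Part (3): a lecturer undersubscribed in M is filled in neither direction, so its
    -- projects keep their sizes.
    undersubscribed-projects-agree : ∀ j → lecCount I M (lec j) < dL (lec j) →
      projCount I M j ≡ projCount I M' j
    undersubscribed-projects-agree j l-under with Fwd.dichotomy (lec j) | Bwd.dichotomy (lec j)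
    ... | inj₁ (l-full' , _) | _ =
      ⊥-elim (<-irrefl (trans (lecturers-agree (lec j)) l-full') l-under)
    ... | inj₂ _ | inj₁ (l-full , _) = ⊥-elim (<-irrefl l-full l-under)
    ... | inj₂ spread | inj₂ spread' = projects-agree spread spread' j refl

theorem3 : (I : SPAST) → (M M' : Assignment I) →
    SuperStable I M → SuperStable I M' →
      (∀ k → lecCount I M k ≡ lecCount I M' k)
      × (∀ s → (M s ≡ nothing) ⇔ (M' s ≡ nothing))
      × (∀ j → lecCount I M (SPAST.lec I j) < SPAST.dL I (SPAST.lec I j) →
           projCount I M j ≡ projCount I M' j)
theorem3 I M M' ss ss' =
    lecturers-agree
  , (λ s → mk⇔ (unassigned-stays ss ss') (unassigned-stays ss' ss))
  , undersubscribed-projects-agree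
  where
  open Analysis I
  open Agreement M M' ss ss'
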